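{- Let $n$ be an even positive integer. The digraph $\vec{C}_n \wr \vec{C}_3$ does not admit a type-II 2-factorization that is also a hamiltonian decomposition (i.e. in which every 2-factor is a directed hamiltonian cycle).
   Context: Let $V(\vec{C}_n)=\mathbb{Z}_n$ with arcs $(i,i+1)$ and $V(\vec{C}_3)=\mathbb{Z}_3$ with arcs $(j,j+1)$; $\vec{C}_n\wr\vec{C}_3$ has vertex set $\mathbb{Z}_n\times\mathbb{Z}_3$, with $((g_1,h_1),(g_2,h_2))$ an arc iff $g_2=g_1+1$, or $g_1=g_2$ and $h_2=h_1+1$. Write $i_j$ for $(i,j)$ and $C^i_3$ for the directed 3-cycle $i_0\,i_1\,i_2\,i_0$. A directed 2-factor is a spanning subdigraph that is a vertex-disjoint union of directed cycles; it is of type $k$ if it contains exactly $k$ arcs of $C^i_3$ for every $i\in\mathbb{Z}_n$. A type-II 2-factorization of $\vec{C}_n\wr\vec{C}_3$ is a partition of its arc set into four directed 2-factors: one of type 2, one of type 1 and two of type 0. -}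

module Defs where

open import Data.Nat using (ℕ; zero; suc; _+_; NonZero)
open import Data.Nat.DivMod using (_mod_)
open import Data.Fin using (Fin; toℕ)
import Data.Fin as F
open import Data.Product using (_×_; _,_; ∃)
open import Data.Sum using (_⊎_)
open import Data.Bool using (Bool; true; false; if_then_else_)
open import Relation.Nullary using (does)
open import Relation.Binary.PropositionalEquality using (_≡_)
open import Data.Product.Properties using (≡-dec)
open import Function using (_∘_; id)

next : {n : ℕ} .{{_ : NonZero n}} → Fin n → Fin n
next {n} i = (toℕ i + 1) mod n

-- vertices of C_n ≀ C_3 : Z_n × Z_3 ; (i , j) is written i_j in the paper
V : ℕ → Set
V n = Fin n × Fin 3

Arc : {n : ℕ} .{{_ : NonZero n}} → V n → V n → Set
Arc (g₁ , h₁) (g₂ , h₂) = (g₂ ≡ next g₁) ⊎ ((g₁ ≡ g₂) × (h₂ ≡ next h₁))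

-- A directed 2-factor: a spanning subdigraph in which every vertex has exactly one
-- out-arc and exactly one in-arc (= vertex-disjoint union of directed cycles).
-- It is given by the successor map `out` (the out-arc of v is (v , out v)), which
-- must be a bijection (`inn` is its inverse), so every vertex has in-degree 1.
record TwoFactor (n : ℕ) .{{_ : NonZero n}} : Set where
  field
    out    : V n → V n
    inn    : V n → V n
    isArc  : ∀ v → Arc v (out v)
    inn∘out : ∀ v → inn (out v) ≡ v
    out∘inn : ∀ v → out (inn v) ≡ v
open TwoFactor public

iter : {A : Set} → (A → A) → ℕ → A → A
iter f zero    = id
iter f (suc m) = f ∘ iter f m

Hamiltonian : {n : ℕ} .{{_ : NonZero n}} → TwoFactor n → Set
Hamiltonian {n} F = ∀ (u v : V n) → ∃ λ m → iter (out F) m u ≡ v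

inC3 : {n : ℕ} .{{_ : NonZero n}} → TwoFactor n → Fin n → Fin 3 → Bool
inC3 F i j = does (≡-dec F._≟_ F._≟_ (out F (i , j)) (i , next j))

count3 : (Fin 3 → Bool) → ℕ
count3 p = b (p F.zero) + (b (p (F.suc F.zero)) + b (p (F.suc (F.suc F.zero))))
  where
  b : Bool → ℕ
  b true  = 1
  b false = 0

HasType : {n : ℕ} .{{_ : NonZero n}} → TwoFactor n → ℕ → Set
HasType {n} F k = ∀ (i : Fin n) → count3 (inC3 F i) ≡ k

-- a family of four 2-factors partitions the arc set: every arc lies in exactly one of them
-- (each factor only uses arcs of the digraph by `isArc`)
Partition : {n : ℕ} .{{_ : NonZero n}} → (Fin 4 → TwoFactor n) → Set
Partition {n} Fs =
  ∀ (u v : V n) → Arc u v →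
    (∃ λ k → out (Fs k) u ≡ v) × (∀ k l → out (Fs k) u ≡ v → out (Fs l) u ≡ v → k ≡ l)

-- type-II 2-factorization: one factor of type 2, one of type 1, two of type 0
-- (labelled, w.l.o.g., as factors 0,1,2,3)
TypeII : {n : ℕ} .{{_ : NonZero n}} → (Fin 4 → TwoFactor n) → Set
TypeII Fs =
  Partition Fs ×
  HasType (Fs F.zero) 2 × HasType (Fs (F.suc F.zero)) 1 ×
  HasType (Fs (F.suc (F.suc F.zero))) 0 × HasType (Fs (F.suc (F.suc (F.suc F.zero)))) 0

HamDecomp : {n : ℕ} .{{_ : NonZero n}} → (Fin 4 → TwoFactor n) → Set
HamDecomp Fs = ∀ k → Hamiltonian (Fs k)

{-# OPTIONS --safe #-}
module Submission where

-- Let F₁ be the type-1 factor, F₂ and F₃ the type-0 factors, and bᵢ the vertex of C³ᵢ whose arc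
-- bᵢ → bᵢ + 1 lies in F₁. F₂ and F₃ map layer i bijectively onto layer i + 1, by permutations σᵢ
-- and μᵢ of Z₃, while F₁ leaves layer i from bᵢ + 1 and bᵢ + 2, towards e₊ and e₋. At these two
-- vertices σᵢ, μᵢ and F₁ form a 2 × 3 Latin rectangle, so σᵢ(bᵢ + 2) − σᵢ(bᵢ + 1) = e₋ − e₊ = sᵢ
-- with sᵢ = ±1: σᵢ is a rotation of Z₃ if sᵢ = + and a reflection if sᵢ = -. If F₂ is
-- hamiltonian, σₙ₋₁ ∘ ⋯ ∘ σ₀ has no fixed point, hence is a rotation, so ∏ sᵢ = +.
-- As {e₊, e₋} = {bᵢ₊₁, bᵢ₊₁ + 2}, F₁ runs along two strands, which are exchanged at layer i
-- exactly when sᵢ = +. For n even the number n − #{i : sᵢ = -} of exchanges is even, so the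
-- cycle of F₁ through b₀ closes after one round and misses b₀ + 2.

open import Defs
open import Data.Bool using (Bool; true; false)
open import Data.Fin as Fin using (Fin; toℕ)
open import Data.Fin.Patterns using (0F; 1F; 2F; 3F)
open import Data.Fin.Properties using (all?; toℕ-fromℕ<; toℕ-injective; toℕ<n)
open import Data.Nat as ℕ using (ℕ; NonZero; zero; suc; _<_; _%_; z<s; s<s)
open import Data.Nat.DivMod using (m<n⇒m%n≡m; n%n≡0)
open import Data.Nat.Divisibility using (_∣_; divides; ∣1⇒≡1)
open import Data.Nat.Properties using (m≤n⇒m<n∨m≡n; +-comm; n<1+n; <-trans; <-irrefl; 1+n≢n)
open import Data.Product using (_×_; _,_; ∃; proj₁; proj₂)
open import Data.Product.Properties using (≡-dec)
open import Data.Sign using (Sign; +; -; opposite; _*_)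
open import Data.Sign.Properties using (*-assoc; *-comm; opposite-involutive; *-commutativeSemigroup)
open import Algebra.Properties.CommutativeSemigroup *-commutativeSemigroup using (x∙yz≈y∙xz)
open import Data.Sum using (_⊎_; inj₁; inj₂)
open import Function using (_∘_; id)
open import Function.Definitions using (Injective)
open import Relation.Binary.PropositionalEquality
open import Relation.Nullary using (¬_; Dec; invert; proof; contradiction)
open import Relation.Nullary.Decidable using (from-yes; map′; ¬?; _→-dec_; _×-dec_; _⊎-dec_)
open import Relation.Nullary.Reflects using (Reflects)

module _ {n : ℕ} .{{_ : NonZero n}} where

  toℕ-next : (i : Fin n) → toℕ (next i) ≡ (toℕ i ℕ.+ 1) % n
  toℕ-next i = toℕ-fromℕ< _

  toℕ-next-< : (i : Fin n) → suc (toℕ i) < n → toℕ (next i) ≡ suc (toℕ i)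
  toℕ-next-< i lt = begin
    toℕ (next i)         ≡⟨ toℕ-next i ⟩
    (toℕ i ℕ.+ 1) % n    ≡⟨ cong (_% n) (+-comm (toℕ i) 1) ⟩
    suc (toℕ i) % n      ≡⟨ m<n⇒m%n≡m lt ⟩
    suc (toℕ i)          ∎
    where open ≡-Reasoning

  toℕ-next-last : (i : Fin n) → suc (toℕ i) ≡ n → toℕ (next i) ≡ 0
  toℕ-next-last i last = begin
    toℕ (next i)         ≡⟨ toℕ-next i ⟩
    (toℕ i ℕ.+ 1) % n    ≡⟨ cong (_% n) (trans (+-comm (toℕ i) 1) last) ⟩
    n % n                ≡⟨ n%n≡0 n ⟩
    0                    ∎
    where open ≡-Reasoning

  next-irrefl : 1 < n → (i : Fin n) → next i ≢ i
  next-irrefl 1<n i fixed with m≤n⇒m<n∨m≡n (toℕ<n i)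
  ... | inj₁ lt   = 1+n≢n (trans (sym (toℕ-next-< i lt)) (cong toℕ fixed))
  ... | inj₂ last = <-irrefl (trans (cong suc (sym toℕi≡0)) last) 1<n
    where
    toℕi≡0 : toℕ i ≡ 0
    toℕi≡0 = trans (sym (cong toℕ fixed)) (toℕ-next-last i last)

layer : ∀ {m} → ℕ → Fin (suc m)
layer k = iter next k 0F

module _ {m : ℕ} where

  toℕ-layer : ∀ {k} → k < suc m → toℕ (layer {m} k) ≡ k
  toℕ-layer {zero}  _  = refl
  toℕ-layer {suc k} lt = begin
    toℕ (next (layer k))   ≡⟨ toℕ-next-< (layer k) (subst (λ j → suc j < suc m) (sym (toℕ-layer k<n)) lt) ⟩
    suc (toℕ (layer k))    ≡⟨ cong suc (toℕ-layer k<n) ⟩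
    suc k                  ∎
    where
    open ≡-Reasoning
    k<n : k < suc m
    k<n = <-trans (n<1+n k) lt

  layer-period : layer {m} (suc m) ≡ 0F
  layer-period = toℕ-injective (toℕ-next-last (layer m) (cong suc (toℕ-layer (n<1+n m))))

  layer-suc≢0 : ∀ {k} → suc k < suc m → layer {m} (suc k) ≢ 0F
  layer-suc≢0 lt e with () ← trans (sym (toℕ-layer lt)) (cong toℕ e)

-- Step ± x y says y = x ± 1 in Z₃; Orients + f says that f is a rotation of Z₃ (an even
-- permutation) and Orients - f that it is a reflection (an odd one).

Step : Sign → Fin 3 → Fin 3 → Set
Step + x y = y ≡ next x
Step - x y = y ≡ next (next x)

step? : ∀ s x y → Dec (Step s x y)
step? + x y = y Fin.≟ next x
step? - x y = y Fin.≟ next (next x)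

_≢?_ : (x y : Fin 3) → Dec (x ≢ y)
x ≢? y = ¬? (x Fin.≟ y)

∀-sign? : {P : Sign → Set} → (∀ s → Dec (P s)) → Dec (∀ s → P s)
∀-sign? P? = map′ (λ (p₋ , p₊) → λ { - → p₋ ; + → p₊ }) (λ p → p - , p +) (P? - ×-dec P? +)

next-irrefl₃ : (x : Fin 3) → next x ≢ x
next-irrefl₃ = next-irrefl (s<s z<s)

next²-irrefl₃ : (x : Fin 3) → next (next x) ≢ x
next²-irrefl₃ 0F ()
next²-irrefl₃ 1F ()
next²-irrefl₃ 2F ()

next³ : (x : Fin 3) → next (next (next x)) ≡ x
next³ 0F = refl
next³ 1F = refl
next³ 2F = refl

step-double : ∀ {s x y z} → Step s x y → Step s y z → Step (opposite s) x z
step-double { + }     refl refl = refl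
step-double { - } {x} refl refl = cong next (next³ x)

step-unique : ∀ {s t x y} → Step s x y → Step t x y → s ≡ t
step-unique { + } { + } _ _ = refl
step-unique { - } { - } _ _ = refl
step-unique { + } { - } {x} refl eq   = contradiction (sym eq) (next-irrefl₃ (next x))
step-unique { - } { + } {x} eq   refl = contradiction (sym eq) (next-irrefl₃ (next x))

step-sign : ∀ {x y} → x ≢ y → ∃ λ s → Step s x y
step-sign {x} {y} x≢y with from-yes (all? λ x → all? λ y → x ≢? y →-dec (step? + x y ⊎-dec step? - x y)) x y x≢y
... | inj₁ step = + , step
... | inj₂ step = - , step

step-rigid : ∀ {s x y z} → x ≢ z → y ≢ z → Step s x y → Step s y z
step-rigid {s} {x} {y} {z} = from-yes
  (∀-sign? λ s → all? λ x → all? λ y → all? λ z →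
    x ≢? z →-dec y ≢? z →-dec step? s x y →-dec step? s y z) s x y z

Orients : Sign → (Fin 3 → Fin 3) → Set
Orients s f = ∀ x → Step s (f x) (f (next x))

orients-id : Orients + id
orients-id _ = refl

orients-step : ∀ {s t g x y} → Orients t g → Step s x y → Step (t * s) (g x) (g y)
orients-step { + } { + } o refl = o _
orients-step { + } { - } o refl = o _
orients-step { - } { + } {g = g} {x} o refl = step-double {s = + } {x = g x} (o x) (o (next x))
orients-step { - } { - } {g = g} {x} o refl = step-double {s = - } {x = g x} (o x) (o (next x))

orients-∘ : ∀ {s t f g} → Orients s f → Orients t g → Orients (t * s) (g ∘ f)
orients-∘ of og x = orients-step og (of x)

orientation : ∀ {f} → Injective _≡_ _≡_ f → ∃ λ s → Orients s f
orientation {f} inj with s , step₀₁ ← step-sign {f 0F} {f 1F} ((λ ()) ∘ inj) =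
  let step₁₂ = step-rigid ((λ ()) ∘ inj) ((λ ()) ∘ inj) step₀₁
      step₂₀ = step-rigid ((λ ()) ∘ inj) ((λ ()) ∘ inj) step₁₂
  in  s , λ { 0F → step₀₁ ; 1F → step₁₂ ; 2F → step₂₀ }

reflection-fixedPoint : ∀ {f} → Orients - f → ∃ λ x → f x ≡ x
reflection-fixedPoint {f} o with f 0F in e
... | 0F = 0F , e
... | 1F = 2F , trans (o 1F) (cong (next ∘ next) (trans (o 0F) (cong (next ∘ next) e)))
... | 2F = 1F , trans (o 0F) (cong (next ∘ next) e)

fixedPointFree⇒orients+ : ∀ {s f} → Orients s f → (∀ x → f x ≢ x) → s ≡ +
fixedPointFree⇒orients+ { + } _ _ = refl
fixedPointFree⇒orients+ { - } o noFix with x , fixed ← reflection-fixedPoint o = contradiction fixed (noFix x)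

-- The two rows of a 2 × 3 Latin rectangle over Z₃ differ by a constant shift.
latin-step : ∀ {s u u′ e v v′ e′} → u ≢ u′ → u ≢ e → u′ ≢ e → v ≢ v′ → v ≢ e′ → v′ ≢ e′ →
             u ≢ v → u′ ≢ v′ → Step s e e′ → Step s u v
latin-step {s} {u} {u′} {e} {v} {v′} {e′} = from-yes
  (∀-sign? λ s → all? λ u → all? λ u′ → all? λ e → all? λ v → all? λ v′ → all? λ e′ →
    u ≢? u′ →-dec u ≢? e →-dec u′ ≢? e →-dec v ≢? v′ →-dec v ≢? e′ →-dec v′ ≢? e′ →-dec
    u ≢? v →-dec u′ ≢? v′ →-dec step? s e e′ →-dec step? s u v) s u u′ e v v′ e′

-- A type-1 factor uses the arc b → b + 1 of C³ᵢ and leaves layer i from b + 1 and b + 2. Its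
-- strand + enters the layer at b and leaves from b + 1, its strand - enters and leaves at b + 2.

leave : Sign → Fin 3 → Fin 3
leave + b = next b
leave - b = next (next b)

entry : Sign → Fin 3 → Fin 3
entry + b = b
entry - b = next (next b)

exits-entries : ∀ {s} b {e₊ e₋} → e₊ ≢ next b → e₋ ≢ next b → Step s e₊ e₋ →
                e₊ ≡ entry (opposite s) b × e₋ ≡ entry s b
exits-entries {s} b {e₊} {e₋} = from-yes
  (∀-sign? λ s → all? λ b → all? λ e₊ → all? λ e₋ →
    e₊ ≢? next b →-dec e₋ ≢? next b →-dec step? s e₊ e₋ →-dec
    (e₊ Fin.≟ entry (opposite s) b ×-dec e₋ Fin.≟ entry s b)) s b e₊ e₋

count3≡0 : (p : Fin 3 → Bool) → count3 p ≡ 0 → ∀ j → p j ≡ false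
count3≡0 p h j with p 0F in e₀ | p 1F in e₁ | p 2F in e₂
count3≡0 p h 0F | false | false | false = e₀
count3≡0 p h 1F | false | false | false = e₁
count3≡0 p h 2F | false | false | false = e₂

count3≡1 : (p : Fin 3 → Bool) → count3 p ≡ 1 → ∃ λ b → p b ≡ true × p (next b) ≡ false × p (next (next b)) ≡ false
count3≡1 p h with p 0F in e₀ | p 1F in e₁ | p 2F in e₂
... | true  | false | false = 0F , e₀ , e₁ , e₂
... | false | true  | false = 1F , e₁ , e₂ , e₀
... | false | false | true  = 2F , e₂ , e₀ , e₁

module _ {n : ℕ} .{{_ : NonZero n}} where

  out-injective : (G : TwoFactor n) → Injective _≡_ _≡_ (out G)
  out-injective G {u} {v} eq = begin
    u                 ≡⟨ inn∘out G u ⟨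
    inn G (out G u)   ≡⟨ cong (inn G) eq ⟩
    inn G (out G v)   ≡⟨ inn∘out G v ⟩
    v                 ∎
    where open ≡-Reasoning

  factors-disjoint : ∀ {Fs} → Partition Fs → ∀ {k l u} → out (Fs k) u ≡ out (Fs l) u → k ≡ l
  factors-disjoint {Fs} partition {k} {l} {u} eq =
    proj₂ (partition u (out (Fs k) u) (isArc (Fs k) u)) k l refl (sym eq)

  inC3-reflects : (G : TwoFactor n) (i : Fin n) (j : Fin 3) → Reflects (out G (i , j) ≡ (i , next j)) (inC3 G i j)
  inC3-reflects G i j = proof (≡-dec Fin._≟_ Fin._≟_ (out G (i , j)) (i , next j))

  out-C3 : (G : TwoFactor n) {i : Fin n} {j : Fin 3} → inC3 G i j ≡ true → out G (i , j) ≡ (i , next j)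
  out-C3 G {i} {j} used = invert (subst (Reflects _) used (inC3-reflects G i j))

  leaves-layer : (G : TwoFactor n) {i : Fin n} {j : Fin 3} → inC3 G i j ≡ false → proj₁ (out G (i , j)) ≡ next i
  leaves-layer G {i} {j} unused with isArc G (i , j)
  ... | inj₁ arc = arc
  ... | inj₂ (same-layer , C3-arc) =
    contradiction (cong₂ _,_ (sym same-layer) C3-arc) (invert (subst (Reflects _) unused (inC3-reflects G i j)))

  layerMap : TwoFactor n → Fin n → Fin 3 → Fin 3
  layerMap G i j = proj₂ (out G (i , j))

  module _ (G : TwoFactor n) (type0 : HasType G 0) where

    out-type0 : ∀ i j → out G (i , j) ≡ (next i , layerMap G i j)
    out-type0 i j = cong (_, layerMap G i j) (leaves-layer G (count3≡0 (inC3 G i) (type0 i) j))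

    layerMap-injective : ∀ i → Injective _≡_ _≡_ (layerMap G i)
    layerMap-injective i {x} {y} eq = cong proj₂ (out-injective G (begin
      out G (i , x)               ≡⟨ out-type0 i x ⟩
      (next i , layerMap G i x)   ≡⟨ cong (next i ,_) eq ⟩
      (next i , layerMap G i y)   ≡⟨ out-type0 i y ⟨
      out G (i , y)               ∎))
      where open ≡-Reasoning

  module Type1 (G : TwoFactor n) (type1 : HasType G 1) where

    base : Fin n → Fin 3
    base i = proj₁ (count3≡1 (inC3 G i) (type1 i))

    C3-usage : ∀ i → inC3 G i (base i) ≡ true × inC3 G i (leave + (base i)) ≡ false × inC3 G i (leave - (base i)) ≡ false
    C3-usage i = proj₂ (count3≡1 (inC3 G i) (type1 i))

    out-base : ∀ i → out G (i , base i) ≡ (i , next (base i))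
    out-base i = out-C3 G (proj₁ (C3-usage i))

    exit : Sign → Fin n → Fin 3
    exit ε i = proj₂ (out G (i , leave ε (base i)))

    out-leave : ∀ ε i → out G (i , leave ε (base i)) ≡ (next i , exit ε i)
    out-leave + i = cong (_, exit + i) (leaves-layer G (proj₁ (proj₂ (C3-usage i))))
    out-leave - i = cong (_, exit - i) (leaves-layer G (proj₂ (proj₂ (C3-usage i))))

    exit₊≢exit₋ : ∀ i → exit + i ≢ exit - i
    exit₊≢exit₋ i eq = next-irrefl₃ (next (base i)) (sym (cong proj₂ (out-injective G (begin
      out G (i , leave + (base i))   ≡⟨ out-leave + i ⟩
      (next i , exit + i)            ≡⟨ cong (next i ,_) eq ⟩
      (next i , exit - i)            ≡⟨ out-leave - i ⟨
      out G (i , leave - (base i))   ∎))))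
      where open ≡-Reasoning

    exit≢next-base : 1 < n → ∀ ε i → exit ε i ≢ next (base (next i))
    exit≢next-base 1<n ε i eq = next-irrefl 1<n i (sym (cong proj₁ (out-injective G (begin
      out G (i , leave ε (base i))      ≡⟨ out-leave ε i ⟩
      (next i , exit ε i)               ≡⟨ cong (next i ,_) eq ⟩
      (next i , next (base (next i)))   ≡⟨ out-base (next i) ⟨
      out G (next i , base (next i))    ∎))))
      where open ≡-Reasoning

    exitSign : Fin n → Sign
    exitSign i = proj₁ (step-sign (exit₊≢exit₋ i))

    exit-step : ∀ i → Step (exitSign i) (exit + i) (exit - i)
    exit-step i = proj₂ (step-sign (exit₊≢exit₋ i))

    exit-entry : 1 < n → ∀ ε i → exit ε i ≡ entry (ε * opposite (exitSign i)) (base (next i))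
    exit-entry 1<n ε i with exits-entries (base (next i)) (exit≢next-base 1<n + i) (exit≢next-base 1<n - i) (exit-step i)
    exit-entry 1<n + i | exit₊ , _ = exit₊
    exit-entry 1<n - i | _ , exit₋ =
      trans exit₋ (cong (λ s → entry s (base (next i))) (sym (opposite-involutive (exitSign i))))

iter-preserves : ∀ {A : Set} {S : A → Set} (f : A → A) → (∀ v → S v → S (f v)) → ∀ k u → S u → S (iter f k u)
iter-preserves f closed zero    u s = s
iter-preserves f closed (suc k) u s = closed _ (iter-preserves f closed k u s)

module _ {m : ℕ} (G : TwoFactor (suc m)) where

  hamiltonian-sweep : Hamiltonian G → (P : ℕ → V (suc m) → Set) →
    (∀ k v → P k v → P k (out G v) ⊎ P (suc k) (out G v)) → (∀ v → P (suc m) v → P 0 v) →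
    ∀ {u} → P 0 u → ∀ v → ∃ λ k → k < suc m × P k v
  hamiltonian-sweep ham P advance wrap {u} start v =
    subst Swept (proj₂ (ham u v)) (iter-preserves (out G) swept-closed (proj₁ (ham u v)) u (0 , z<s , start))
    where
    Swept : V (suc m) → Set
    Swept v = ∃ λ k → k < suc m × P k v
    swept-closed : ∀ v → Swept v → Swept (out G v)
    swept-closed v (k , k<n , p) with advance k v p
    ... | inj₁ p′ = k , k<n , p′
    ... | inj₂ p′ with m≤n⇒m<n∨m≡n k<n
    ...   | inj₁ k+1<n = suc k , k+1<n , p′
    ...   | inj₂ refl  = 0 , z<s , wrap _ p′

  transport : ℕ → Fin 3 → Fin 3
  transport zero    = id
  transport (suc k) = layerMap G (layer k) ∘ transport k

  transport-fixedPointFree : HasType G 0 → Hamiltonian G → ∀ x → transport (suc m) x ≢ x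
  transport-fixedPointFree type0 ham x fixed =
    missed (hamiltonian-sweep ham OnTrack (λ k v → inj₂ ∘ advance k) (λ _ → wrap) refl (0F , next x))
    where
    OnTrack : ℕ → V (suc m) → Set
    OnTrack k v = v ≡ (layer k , transport k x)
    advance : ∀ k {v} → OnTrack k v → OnTrack (suc k) (out G v)
    advance k refl = out-type0 G type0 (layer k) (transport k x)
    wrap : ∀ {v} → OnTrack (suc m) v → OnTrack 0 v
    wrap refl = cong₂ _,_ layer-period fixed
    missed : ¬ ∃ λ k → k < suc m × OnTrack k (0F , next x)
    missed (zero  , _   , eq) = next-irrefl₃ x (cong proj₂ eq)
    missed (suc k , k<n , eq) = layer-suc≢0 k<n (sym (cong proj₁ eq))

module Strands {m : ℕ} (G : TwoFactor (suc m)) (type1 : HasType G 1) where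
  open Type1 G type1

  strand : ℕ → Sign
  strand zero    = +
  strand (suc k) = strand k * opposite (exitSign (layer k))

  OnStrand : Fin (suc m) → Sign → V (suc m) → Set
  OnStrand i ε v = v ≡ (i , entry ε (base i)) ⊎ (ε ≡ + × v ≡ (i , next (base i)))

  onStrand-advance : 1 < suc m → ∀ {i ε v} → OnStrand i ε v →
    OnStrand i ε (out G v) ⊎ OnStrand (next i) (ε * opposite (exitSign i)) (out G v)
  onStrand-advance _   {i} { + } (inj₁ refl)       = inj₁ (inj₂ (refl , out-base i))
  onStrand-advance 1<n {i} { - } (inj₁ refl)       = inj₂ (inj₁ (trans (out-leave - i) (cong (next i ,_) (exit-entry 1<n - i))))
  onStrand-advance 1<n {i} { + } (inj₂ (_ , refl)) = inj₂ (inj₁ (trans (out-leave + i) (cong (next i ,_) (exit-entry 1<n + i))))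

  strand-period-¬hamiltonian : 1 < suc m → strand (suc m) ≡ + → ¬ Hamiltonian G
  strand-period-¬hamiltonian 1<n period ham =
    missed (hamiltonian-sweep G ham (λ k → OnStrand (layer k) (strand k)) (λ _ _ → onStrand-advance 1<n) (λ _ → wrap)
                              (inj₁ refl) (0F , entry - (base 0F)))
    where
    wrap : ∀ {v} → OnStrand (layer (suc m)) (strand (suc m)) v → OnStrand 0F + v
    wrap {v} = subst₂ (λ i ε → OnStrand i ε v) layer-period period
    missed : ¬ ∃ λ k → k < suc m × OnStrand (layer k) (strand k) (0F , entry - (base 0F))
    missed (zero  , _   , inj₁ eq)       = next²-irrefl₃ (base 0F) (cong proj₂ eq)
    missed (zero  , _   , inj₂ (_ , eq)) = next-irrefl₃ (next (base 0F)) (cong proj₂ eq)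
    missed (suc k , k<n , inj₁ eq)       = layer-suc≢0 k<n (sym (cong proj₁ eq))
    missed (suc k , k<n , inj₂ (_ , eq)) = layer-suc≢0 k<n (sym (cong proj₁ eq))

parity : ℕ → Sign
parity zero    = +
parity (suc k) = opposite (parity k)

parity-even : ∀ {n} → 2 ∣ n → parity n ≡ +
parity-even (divides q refl) = parity-double q
  where
  parity-double : ∀ q → parity (q ℕ.* 2) ≡ +
  parity-double zero    = refl
  parity-double (suc q) = trans (opposite-involutive (parity (q ℕ.* 2))) (parity-double q)

module TypeIIFactorization {m : ℕ} (Fs : Fin 4 → TwoFactor (suc m)) (partition : Partition Fs)
  (type1 : HasType (Fs 1F) 1) (type0 : HasType (Fs 2F) 0) (type0′ : HasType (Fs 3F) 0) where

  open Type1 (Fs 1F) type1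
  open Strands (Fs 1F) type1

  layerMap-orients : ∀ i → Orients (exitSign i) (layerMap (Fs 2F) i)
  layerMap-orients i = subst (λ s → Orients s σ) (step-unique (orients (leave + (base i))) σ-step) orients
    where
    σ : Fin 3 → Fin 3
    σ = layerMap (Fs 2F) i
    orients = proj₂ (orientation (layerMap-injective (Fs 2F) type0 i))
    disjoint : ∀ {k l x a c} → k ≢ l → out (Fs k) (i , x) ≡ (next i , a) → out (Fs l) (i , x) ≡ (next i , c) → a ≢ c
    disjoint k≢l eq eq′ a≡c = k≢l (factors-disjoint {Fs = Fs} partition (trans eq (trans (cong (next i ,_) a≡c) (sym eq′))))
    σ-step : Step (exitSign i) (σ (leave + (base i))) (σ (leave - (base i)))
    σ-step = latin-step
      (disjoint (λ ()) (out-type0 (Fs 2F) type0 i _) (out-type0 (Fs 3F) type0′ i _))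
      (disjoint (λ ()) (out-type0 (Fs 2F) type0 i _) (out-leave + i))
      (disjoint (λ ()) (out-type0 (Fs 3F) type0′ i _) (out-leave + i))
      (disjoint (λ ()) (out-type0 (Fs 2F) type0 i _) (out-type0 (Fs 3F) type0′ i _))
      (disjoint (λ ()) (out-type0 (Fs 2F) type0 i _) (out-leave - i))
      (disjoint (λ ()) (out-type0 (Fs 3F) type0′ i _) (out-leave - i))
      (next-irrefl₃ (leave + (base i)) ∘ sym ∘ layerMap-injective (Fs 2F) type0 i)
      (next-irrefl₃ (leave + (base i)) ∘ sym ∘ layerMap-injective (Fs 3F) type0′ i)
      (exit-step i)

  exitProduct : ℕ → Sign
  exitProduct zero    = +
  exitProduct (suc k) = exitSign (layer k) * exitProduct k

  transport-orients : ∀ k → Orients (exitProduct k) (transport (Fs 2F) k)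
  transport-orients zero    = orients-id
  transport-orients (suc k) = orients-∘ (transport-orients k) (layerMap-orients (layer k))

  strand≡parity*exitProduct : ∀ k → strand k ≡ parity k * exitProduct k
  strand≡parity*exitProduct zero    = refl
  strand≡parity*exitProduct (suc k) = begin
    strand k * opposite s           ≡⟨ cong (_* opposite s) (strand≡parity*exitProduct k) ⟩
    parity k * P * opposite s       ≡⟨ *-comm (parity k * P) (- * s) ⟩
    - * s * (parity k * P)          ≡⟨ *-assoc - s (parity k * P) ⟩
    - * (s * (parity k * P))        ≡⟨ cong (- *_) (x∙yz≈y∙xz s (parity k) P) ⟩
    - * (parity k * (s * P))        ≡⟨ *-assoc - (parity k) (s * P) ⟨
    opposite (parity k) * (s * P)   ∎
    where
    open ≡-Reasoning
    s = exitSign (layer k)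
    P = exitProduct k

  no-hamiltonian-decomposition : 1 < suc m → 2 ∣ suc m → ¬ HamDecomp Fs
  no-hamiltonian-decomposition 1<n even ham = strand-period-¬hamiltonian 1<n strand-period (ham 1F)
    where
    exitProduct-period : exitProduct (suc m) ≡ +
    exitProduct-period = fixedPointFree⇒orients+ (transport-orients (suc m))
                                                 (transport-fixedPointFree (Fs 2F) type0 (ham 2F))
    strand-period : strand (suc m) ≡ +
    strand-period = begin
      strand (suc m)                         ≡⟨ strand≡parity*exitProduct (suc m) ⟩
      parity (suc m) * exitProduct (suc m)   ≡⟨ cong₂ _*_ (parity-even even) exitProduct-period ⟩
      +                                      ∎
      where open ≡-Reasoning

proposition6p26 : (n : ℕ) .{{_ : NonZero n}} → 2 ∣ n →
    ¬ (∃ λ (Fs : Fin 4 → TwoFactor n) → TypeII Fs × HamDecomp Fs)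
proposition6p26 (suc zero) 2∣1 _ with () ← ∣1⇒≡1 2∣1
proposition6p26 (suc (suc m)) even (Fs , (partition , _ , type1 , type0 , type0′) , ham) =
  TypeIIFactorization.no-hamiltonian-decomposition Fs partition type1 type0 type0′ (s<s z<s) even ham
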